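{- Let $B,C$ be finite rooted trees. Then $B\cong C$ if and only if $o(B)=o(C)$.
   Context: A tree is a finite acyclic connected directed graph with a distinguished root $r$ (edges directed away from the root); $B\cong C$ means there is an isomorphism of rooted directed graphs (not required to respect any ordering of children). If $B$ is not just the root, write $B=(B_1,\dots,B_n)$ where $B_1,\dots,B_n$ are the subtrees rooted at the successors of the root. Define the ordinal $o(B)$ recursively: $o(r)=0$ for the one-vertex tree, and $o(B)=\sum_{i=1}^n\omega^{o(B_{\pi(i)})}$ (ordinal sum) where $\pi$ is a permutation of $\{1,\dots,n\}$ with $o(B_{\pi(1)})\ge\dots\ge o(B_{\pi(n)})$. -}

module Defs where

open import Data.List using (List; []; _∷_; length; lookup)
open import Data.Fin using (Fin)
open import Data.Bool using (Bool; true; false)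
open import Function.Bundles using (_↔_; Inverse)

-- Finite rooted trees: a root together with the (finite) list of
-- subtrees rooted at its successors.  The order of the list carries no
-- meaning; isomorphism below ignores it.

data Tree : Set where
  node : List Tree → Tree

data _≅_ : Tree → Tree → Set where
  node-≅ : ∀ {ts us} (f : Fin (length ts) ↔ Fin (length us)) →
           (∀ i → lookup ts i ≅ lookup us (Inverse.to f i)) →
           node ts ≅ node us

-- Ordinals below ε₀ in Cantor normal form:
--   ω^ a + b  denotes  ω^a + b  (normal when b = 0 or b's leading
--   exponent is ≤ a).  All ordinals produced by `o` are in normal form,
--   so propositional equality ≡ coincides with ordinal equality on them.

data Cnf : Set where
  𝟎    : Cnf
  ω^_+_ : Cnf → Cnf → Cnf

infixr 6 ω^_+_

data Cmp : Set where
  lt eq gt : Cmp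

cmp : Cnf → Cnf → Cmp
cmp 𝟎 𝟎 = eq
cmp 𝟎 (ω^ _ + _) = lt
cmp (ω^ _ + _) 𝟎 = gt
cmp (ω^ a + b) (ω^ c + d) with cmp a c
... | lt = lt
... | gt = gt
... | eq = cmp b d

infixl 5 _⊕_
_⊕_ : Cnf → Cnf → Cnf
𝟎 ⊕ b = b
(ω^ a + c) ⊕ 𝟎 = ω^ a + c
(ω^ a + c) ⊕ (ω^ b₁ + b₂) with cmp a b₁
... | lt = ω^ b₁ + b₂
... | eq = ω^ a + (c ⊕ (ω^ b₁ + b₂))
... | gt = ω^ a + (c ⊕ (ω^ b₁ + b₂))

ωpow : Cnf → Cnf
ωpow a = ω^ a + 𝟎

insert : Cnf → List Cnf → List Cnf
insert x [] = x ∷ []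
insert x (y ∷ ys) with cmp x y
... | lt = y ∷ insert x ys
... | eq = x ∷ y ∷ ys
... | gt = x ∷ y ∷ ys

sortDesc : List Cnf → List Cnf
sortDesc [] = []
sortDesc (x ∷ xs) = insert x (sortDesc xs)

sumω : List Cnf → Cnf
sumω [] = 𝟎
sumω (x ∷ xs) = ωpow x ⊕ sumω xs

mutual
  o : Tree → Cnf
  o (node ts) = sumω (sortDesc (os ts))

  os : List Tree → List Cnf
  os [] = []
  os (t ∷ ts) = o t ∷ os ts

module Submission where

-- The ordinal o (node ts) is the ordinal sum of ω^(o t) over the children,
-- taken in non-increasing order; on such an exponent list no absorption
-- occurs, so o (node ts) is the Cantor normal form whose exponent list is the
-- sorted list of child ordinals, and it determines that list.

open import Defs
open import Data.Empty using (⊥-elim)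
open import Data.Fin using (Fin; zero; suc; cast; punchIn)
open import Data.Fin.Permutation using (remove; cast-id; _∘ₚ_; _⟨$⟩ʳ_; punchIn-permute)
open import Data.Fin.Properties using (cast-is-id; ¬Fin0)
open import Data.List using (List; []; _∷_; length; lookup; removeAt; map)
open import Data.List.Properties using (length-removeAt′)
open import Data.List.Relation.Binary.Pointwise as Pointwise using (Pointwise; Pointwise-≡⇒≡; ≡⇒Pointwise-≡)
open import Data.List.Relation.Unary.Linked using (Linked; []; [-]; _∷_)
import Data.List.Relation.Unary.Linked.Properties as Linked
import Data.List.Relation.Binary.Permutation.Setoid as SetoidPermutation
import Data.List.Relation.Binary.Permutation.Setoid.Properties as SetoidPermutationProperties
import Data.List.Relation.Unary.Sorted.TotalOrder.Properties as SortedProperties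
import Data.List.Sort.InsertionSort.Base as InsertionSort
import Data.List.Sort.InsertionSort.Properties as InsertionSortProperties
open import Data.List.Sort.Base using (SortingAlgorithm)
open import Data.Nat using (pred)
open import Data.Product using (_×_; _,_)
open import Data.Sum using (inj₁; inj₂)
open import Function using (_∘_; _on_)
open import Function.Bundles using (_↔_; Inverse)
open import Relation.Binary.Bundles using (Setoid; DecTotalOrder)
import Relation.Binary.Construct.On as On
import Relation.Binary.Reasoning.Setoid as SetoidReasoning
open import Relation.Binary.Definitions using (Transitive; Antisymmetric; Total; Decidable)
open import Relation.Binary.PropositionalEquality
open import Relation.Nullary using (yes; no)

flipCmp : Cmp → Cmp
flipCmp lt = gt
flipCmp eq = eq
flipCmp gt = lt

cmp-refl : ∀ a → cmp a a ≡ eq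
cmp-refl 𝟎 = refl
cmp-refl (ω^ a + b) rewrite cmp-refl a = cmp-refl b

cmp-eq⇒≡ : ∀ a b → cmp a b ≡ eq → a ≡ b
cmp-eq⇒≡ 𝟎 𝟎 _ = refl
cmp-eq⇒≡ (ω^ a + b) (ω^ c + d) p with cmp a c in ac
... | eq = cong₂ ω^_+_ (cmp-eq⇒≡ a c ac) (cmp-eq⇒≡ b d p)

cmp-flip : ∀ a b → cmp b a ≡ flipCmp (cmp a b)
cmp-flip 𝟎 𝟎 = refl
cmp-flip 𝟎 (ω^ _ + _) = refl
cmp-flip (ω^ _ + _) 𝟎 = refl
cmp-flip (ω^ a + b) (ω^ c + d) rewrite cmp-flip a c with cmp a c
... | lt = refl
... | eq = cmp-flip b d
... | gt = refl

cmp-gt⇒flip-lt : ∀ a b → cmp a b ≡ gt → cmp b a ≡ lt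
cmp-gt⇒flip-lt a b ab = trans (cmp-flip a b) (cong flipCmp ab)

cmp-lt-trans : ∀ a b c → cmp a b ≡ lt → cmp b c ≡ lt → cmp a c ≡ lt
cmp-lt-trans 𝟎 (ω^ _ + _) (ω^ _ + _) _ _ = refl
cmp-lt-trans (ω^ a + b) (ω^ c + d) (ω^ e + f) p q with cmp a c in ac | cmp c e in ce
... | lt | lt rewrite cmp-lt-trans a c e ac ce = refl
... | lt | eq rewrite sym (cmp-eq⇒≡ c e ce) | ac = refl
... | eq | lt rewrite cmp-eq⇒≡ a c ac | ce = refl
... | eq | eq rewrite cmp-eq⇒≡ a c ac | cmp-eq⇒≡ c e ce | cmp-refl e = cmp-lt-trans b d f p q

infix 4 _⊒_
_⊒_ : Cnf → Cnf → Set
a ⊒ b = cmp a b ≢ lt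

⊒-refl : ∀ a → a ⊒ a
⊒-refl a rewrite cmp-refl a = λ ()

⊒-trans : Transitive _⊒_
⊒-trans {a} {b} {c} a⊒b b⊒c ac with cmp a b in ab
... | lt = a⊒b refl
... | eq rewrite cmp-eq⇒≡ a b ab = b⊒c ac
... | gt = b⊒c (cmp-lt-trans b a c (cmp-gt⇒flip-lt a b ab) ac)

⊒-antisym : Antisymmetric _≡_ _⊒_
⊒-antisym {a} {b} a⊒b b⊒a with cmp a b in ab
... | lt = ⊥-elim (a⊒b refl)
... | eq = cmp-eq⇒≡ a b ab
... | gt = ⊥-elim (b⊒a (cmp-gt⇒flip-lt a b ab))

⊒-total : Total _⊒_
⊒-total a b rewrite cmp-flip a b with cmp a b
... | lt = inj₂ λ ()
... | eq = inj₁ λ ()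
... | gt = inj₁ λ ()

_⊒?_ : Decidable _⊒_
a ⊒? b with cmp a b
... | lt = no λ a⋣b → a⋣b refl
... | eq = yes λ ()
... | gt = yes λ ()

_≟_ : Decidable {A = Cnf} _≡_
a ≟ b with cmp a b in ab
... | eq = yes (cmp-eq⇒≡ a b ab)
... | lt = no λ { refl → ⊒-refl a ab }
... | gt = no λ { refl → ⊒-refl a (cmp-gt⇒flip-lt a a ab) }

⊒-decTotalOrder : DecTotalOrder _ _ _
⊒-decTotalOrder = record
  { Carrier = Cnf
  ; _≈_ = _≡_
  ; _≤_ = _⊒_
  ; isDecTotalOrder = record
    { isTotalOrder = record
      { isPartialOrder = record
        { isPreorder = record
          { isEquivalence = isEquivalence
          ; reflexive = λ { {a} refl → ⊒-refl a }
          ; trans = λ {a b c} → ⊒-trans {a} {b} {c}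
          }
        ; antisym = ⊒-antisym
        }
      ; total = ⊒-total
      }
    ; _≟_ = _≟_
    ; _≤?_ = _⊒?_
    }
  }

cnf : List Cnf → Cnf
cnf [] = 𝟎
cnf (α ∷ αs) = ω^ α + cnf αs

cnf-injective : ∀ αs βs → cnf αs ≡ cnf βs → αs ≡ βs
cnf-injective [] [] _ = refl
cnf-injective (α ∷ αs) (β ∷ βs) e =
  cong₂ _∷_ (cong leadingExponent e) (cnf-injective αs βs (cong remainder e))
  where
  leadingExponent remainder : Cnf → Cnf
  leadingExponent 𝟎 = 𝟎
  leadingExponent (ω^ α + _) = α
  remainder 𝟎 = 𝟎
  remainder (ω^ _ + γ) = γ

-- when the exponents do not increase, no absorption happens in the ordinal sum
sumω-nonincreasing : ∀ {αs} → Linked _⊒_ αs → sumω αs ≡ cnf αs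
sumω-nonincreasing [] = refl
sumω-nonincreasing [-] = refl
sumω-nonincreasing {α ∷ β ∷ αs} (α⊒β ∷ rest) rewrite sumω-nonincreasing rest with cmp α β
... | lt = ⊥-elim (α⊒β refl)
... | eq = refl
... | gt = refl

module _ {a ℓ} (S : Setoid a ℓ) where
  open Setoid S using (_≈_) renaming (Carrier to A)
  open SetoidPermutation S using (_↭_; ↭-refl; ↭-trans; ↭-prep; ↭-swap; prep)

  lookup∷removeAt↭ : ∀ (xs : List A) j → lookup xs j ∷ removeAt xs j ↭ xs
  lookup∷removeAt↭ (x ∷ xs) zero = ↭-refl
  lookup∷removeAt↭ (x ∷ xs) (suc j) =
    ↭-trans (↭-swap (lookup xs j) x ↭-refl) (↭-prep x (lookup∷removeAt↭ xs j))

  lookup-removeAt : ∀ (y : A) ys (j : Fin (length (y ∷ ys))) (k : Fin (length ys))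
    .(e : length ys ≡ length (removeAt (y ∷ ys) j)) →
    lookup (removeAt (y ∷ ys) j) (cast e k) ≡ lookup (y ∷ ys) (punchIn j k)
  lookup-removeAt y ys zero k e = cong (lookup ys) (cast-is-id e k)
  lookup-removeAt y (y′ ∷ ys) (suc j) zero e = refl
  lookup-removeAt y (y′ ∷ ys) (suc j) (suc k) e = lookup-removeAt y′ ys j k _

  -- a bijection of indices matching related entries yields a permutation:
  -- match the head of xs with its image, then recurse on the rest with the
  -- bijection obtained by removing that pair
  bijection⇒↭ : ∀ xs ys (f : Fin (length xs) ↔ Fin (length ys)) →
    (∀ i → lookup xs i ≈ lookup ys (Inverse.to f i)) → xs ↭ ys
  bijection⇒↭ [] [] f related = ↭-refl
  bijection⇒↭ [] (y ∷ ys) f related = ⊥-elim (¬Fin0 (Inverse.from f zero))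
  bijection⇒↭ (x ∷ xs) [] f related = ⊥-elim (¬Fin0 (Inverse.to f zero))
  bijection⇒↭ (x ∷ xs) (y ∷ ys) f related =
    ↭-trans (prep (related zero) rest↭) (lookup∷removeAt↭ (y ∷ ys) j)
    where
    j : Fin (length (y ∷ ys))
    j = Inverse.to f zero
    e : length ys ≡ length (removeAt (y ∷ ys) j)
    e = cong pred (length-removeAt′ (y ∷ ys) j)
    rest↭ : xs ↭ removeAt (y ∷ ys) j
    rest↭ = bijection⇒↭ xs (removeAt (y ∷ ys) j) (remove zero f ∘ₚ cast-id e) λ k →
      begin
        lookup xs k                                  ≈⟨ related (suc k) ⟩
        lookup (y ∷ ys) (Inverse.to f (suc k))       ≡⟨ cong (lookup (y ∷ ys)) (punchIn-permute f zero k) ⟩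
        lookup (y ∷ ys) (punchIn j (remove zero f ⟨$⟩ʳ k))
                                                     ≡⟨ lookup-removeAt y ys j (remove zero f ⟨$⟩ʳ k) e ⟨
        lookup (removeAt (y ∷ ys) j) (cast e (remove zero f ⟨$⟩ʳ k))
      ∎
      where open SetoidReasoning S

treeOrder : DecTotalOrder _ _ _
treeOrder = On.decTotalOrder ⊒-decTotalOrder o

open DecTotalOrder treeOrder using (totalOrder)

treeSetoid : Setoid _ _
treeSetoid = DecTotalOrder.Eq.setoid treeOrder

open InsertionSort treeOrder using (sort) renaming (insert to insertTree)
open SortingAlgorithm (InsertionSortProperties.insertionSort treeOrder) using (sort-↭ₛ; sort-↗)
open SetoidPermutation treeSetoid using (_↭_; ↭-trans; ↭-sym; ↭-reflexive-≋; onIndices)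
open SetoidPermutationProperties treeSetoid using (onIndices-lookup)
open SortedProperties using (↗↭↗⇒≋)

os≡map : ∀ ts → os ts ≡ map o ts
os≡map [] = refl
os≡map (t ∷ ts) = cong (o t ∷_) (os≡map ts)

map-insert : ∀ t ts → map o (insertTree t ts) ≡ insert (o t) (map o ts)
map-insert t [] = refl
map-insert t (u ∷ us) with cmp (o t) (o u)
... | lt = cong (o u ∷_) (map-insert t us)
... | eq = refl
... | gt = refl

map-sort : ∀ ts → map o (sort ts) ≡ sortDesc (map o ts)
map-sort [] = refl
map-sort (t ∷ ts) = trans (map-insert t (sort ts)) (cong (insert (o t)) (map-sort ts))

o-node : ∀ ts → o (node ts) ≡ cnf (map o (sort ts))
o-node ts = begin
  sumω (sortDesc (os ts))        ≡⟨ cong (sumω ∘ sortDesc) (os≡map ts) ⟩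
  sumω (sortDesc (map o ts))     ≡⟨ cong sumω (map-sort ts) ⟨
  sumω (map o (sort ts))         ≡⟨ sumω-nonincreasing (Linked.map⁺ (sort-↗ ts)) ⟩
  cnf (map o (sort ts))          ∎
  where open ≡-Reasoning

↭⇒o-node≡ : ∀ {ts us} → ts ↭ us → o (node ts) ≡ o (node us)
↭⇒o-node≡ {ts} {us} ts↭us = begin
  o (node ts)              ≡⟨ o-node ts ⟩
  cnf (map o (sort ts))    ≡⟨ cong cnf (Pointwise-≡⇒≡ (Pointwise.map⁺ o o sorted≋)) ⟩
  cnf (map o (sort us))    ≡⟨ o-node us ⟨
  o (node us)              ∎
  where
  open ≡-Reasoning
  sorted≋ : Pointwise (_≡_ on o) (sort ts) (sort us)
  sorted≋ = ↗↭↗⇒≋ totalOrder (sort-↗ ts) (sort-↗ us)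
    (↭-trans (sort-↭ₛ ts) (↭-trans ts↭us (↭-sym (sort-↭ₛ us))))

o-node≡⇒↭ : ∀ ts us → o (node ts) ≡ o (node us) → ts ↭ us
o-node≡⇒↭ ts us e = ↭-trans (↭-sym (sort-↭ₛ ts)) (↭-trans (↭-reflexive-≋ sorted≋) (sort-↭ₛ us))
  where
  sorted≋ : Pointwise (_≡_ on o) (sort ts) (sort us)
  sorted≋ = Pointwise.map⁻ o o (≡⇒Pointwise-≡
    (cnf-injective _ _ (trans (sym (o-node ts)) (trans e (o-node us)))))

≅⇒o≡ : ∀ {B C} → B ≅ C → o B ≡ o C
≅⇒o≡ (node-≅ {ts} {us} f subtrees≅) =
  ↭⇒o-node≡ (bijection⇒↭ treeSetoid ts us f λ i → ≅⇒o≡ (subtrees≅ i))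

mutual
  o≡⇒≅ : ∀ B C → o B ≡ o C → B ≅ C
  o≡⇒≅ (node ts) (node us) e = node-≅ (onIndices ts↭us) λ i →
    o≡⇒≅-child ts i _ (onIndices-lookup ts↭us i)
    where
    ts↭us : ts ↭ us
    ts↭us = o-node≡⇒↭ ts us e

  o≡⇒≅-child : ∀ ts i C → o (lookup ts i) ≡ o C → lookup ts i ≅ C
  o≡⇒≅-child (t ∷ ts) zero = o≡⇒≅ t
  o≡⇒≅-child (t ∷ ts) (suc i) = o≡⇒≅-child ts i

mainTheorem12 : (B C : Tree) → (B ≅ C → o B ≡ o C) × (o B ≡ o C → B ≅ C)
mainTheorem12 B C = ≅⇒o≡ , o≡⇒≅ B C
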